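{- Let $k\ge 1$, let $\omega=(\omega_1,\ldots,\omega_k)$ be a weight vector with rational entries, and let $n\ge 1$. Then the weighted isobaric polynomial $P_{k,n,\omega}$ has at most $\mathcal{P}(n)$ terms, where $\mathcal{P}(n)$ is the number of partitions of $n$. Moreover, for every $\alpha=(\alpha_1,\ldots,\alpha_k)\in\mathbb{Z}_{\ge0}^k$ with $\sum_j j\alpha_j=n$, the coefficient of $t^\alpha$ in $P_{k,n,\omega}$ is $$A_{k,n,\omega}(\alpha)=\binom{\sum_i\alpha_i}{\alpha_1,\ldots,\alpha_k}\,\frac{\sum_i\alpha_i\omega_i}{\sum_i\alpha_i}.$$
   Context: Let $t_1,\ldots,t_k$ be indeterminates. For $\alpha\in\mathbb{Z}_{\ge0}^k$ write $t^\alpha=t_1^{\alpha_1}\cdots t_k^{\alpha_k}$, $|\alpha|=\sum_i\alpha_i$ (the depth) and $\sum_i i\alpha_i$ (the level); write $\alpha\vdash n$ if the level is $n$. Let $e_j$ be the $j$-th unit vector. Given a weight vector $\omega=(\omega_1,\ldots,\omega_k)$, coefficients $A_\omega(\alpha)$ for $|\alpha|\ge1$ are defined recursively on the depth: $A_\omega(e_j)=\omega_j$, and for $|\alpha|\ge2$, $A_\omega(\alpha)=\sum_{j:\alpha_j\ge1}A_\omega(\alpha-e_j)$ (the sum of the coefficients of all monomials $t^\beta$ of depth $|\alpha|-1$ with $\beta_i\le\alpha_i$ for all $i$). The weighted isobaric polynomial (WIP) of level $n$ and weight $\omega$ is $P_{k,n,\omega}=\sum_{\alpha\vdash n}A_\omega(\alpha)t^\alpha$;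 the coefficient $A_\omega(\alpha)$ for $\alpha\vdash n$ is also denoted $A_{k,n,\omega}(\alpha)$. -}

module Defs where

open import Data.Nat as ℕ using (ℕ; zero; suc; _!; _≤_; _≥_)
open import Data.Fin using (Fin; toℕ)
import Data.Fin as Fin
open import Data.Vec using (Vec; []; _∷_; lookup; _[_]%=_; map; toList)
import Data.Vec as Vec
open import Data.List using (List)
import Data.Nat.ListAction as ListA
open import Data.List.Relation.Unary.All using (All)
open import Data.List.Relation.Unary.Linked using (Linked)
open import Data.Integer using (+_)
open import Data.Rational using (ℚ; 0ℚ; _+_; _*_; _/_)
open import Relation.Binary.PropositionalEquality using (_≡_)

ℕtoℚ : ℕ → ℚ
ℕtoℚ m = (+ m) / 1

-- 1/m as a rational, with the (never used) convention 1/0 := 0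
invℕ : ℕ → ℚ
invℕ zero = 0ℚ
invℕ (suc m) = (+ 1) / suc m

sumFin : {k : ℕ} → (Fin k → ℚ) → ℚ
sumFin {zero} f = 0ℚ
sumFin {suc k} f = f Fin.zero + sumFin {k} (λ j → f (Fin.suc j))

-- exponent vectors α = (α_1,…,α_k) ∈ ℤ≥0^k : Vec ℕ k (entry at j : Fin k is α_{toℕ j + 1})

depth : {k : ℕ} → Vec ℕ k → ℕ
depth α = Vec.sum α

levelFrom : {k : ℕ} → ℕ → Vec ℕ k → ℕ
levelFrom s [] = 0
levelFrom s (a ∷ as) = s ℕ.* a ℕ.+ levelFrom (suc s) as

level : {k : ℕ} → Vec ℕ k → ℕ
level α = levelFrom 1 α

ifPos : ℕ → ℚ → ℚ
ifPos zero x = 0ℚ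
ifPos (suc _) x = x

minusE : {k : ℕ} → Vec ℕ k → Fin k → Vec ℕ k
minusE α j = α [ j ]%= ℕ.pred

-- A at depth d (d is meant to be depth α):
--   depth 1 (α = e_j):  A(e_j) = ω_j   (the only j with α_j ≥ 1)
--   depth ≥ 2: A(α) = Σ_{j : α_j ≥ 1} A(α - e_j)
Aᵈ : {k : ℕ} → ℕ → (Fin k → ℚ) → Vec ℕ k → ℚ
Aᵈ zero ω α = 0ℚ
Aᵈ (suc zero) ω α = sumFin (λ j → ifPos (lookup α j) (ω j))
Aᵈ (suc (suc d)) ω α = sumFin (λ j → ifPos (lookup α j) (Aᵈ (suc d) ω (minusE α j)))

-- the coefficient A_ω(α)  (only meaningful for depth α ≥ 1)
A : {k : ℕ} → (Fin k → ℚ) → Vec ℕ k → ℚ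
A ω α = Aᵈ (depth α) ω α

multinomial : {k : ℕ} → Vec ℕ k → ℚ
multinomial α = ℕtoℚ (depth α !) * invℕ (ListA.product (toList (map _! α)))

weightedSum : {k : ℕ} → (Fin k → ℚ) → Vec ℕ k → ℚ
weightedSum ω α = sumFin (λ j → ℕtoℚ (lookup α j) * ω j)

record Partition (n : ℕ) : Set where
  field
    parts    : List ℕ
    positive : All (1 ≤_) parts
    nonincr  : Linked _≥_ parts
    total    : ListA.sum parts ≡ n
open Partition public

{-# OPTIONS --safe #-}

-- Write W(β) = Σᵢ βᵢ ωᵢ and ∏ β! for the product of the factorials of the
-- entries of β.  The closed form amounts to ∏ α! · A(α) = (|α| − 1)! · W(α),
-- proved by induction on the depth |α|.  For |α| = 1 both sides are ω_j.  Above
-- that, multiplying the recursion for A by ∏ α! = αⱼ · ∏ (α − eⱼ)! and applying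
-- the induction hypothesis gives (|α| − 2)! · Σⱼ αⱼ · W(α − eⱼ), and
-- Σⱼ αⱼ · W(α − eⱼ) = (|α| − 1) · W(α) because W(α − eⱼ) = W(α) − ωⱼ when αⱼ ≥ 1.
-- The terms of P_{k,n,ω} inject into the partitions of n by sending α to the
-- partition with αᵢ parts equal to i: listed in decreasing order, the parts
-- determine α.

module Submission where

open import Defs
open import Algebra.Bundles using (CommutativeMonoid; CommutativeRing)
import Algebra.Properties.CommutativeSemigroup as CommutativeSemigroupProperties
import Algebra.Properties.Group as GroupProperties
import Algebra.Properties.Semiring.Sum as SemiringSum
open import Data.Empty using (⊥-elim)
open import Data.Fin using (Fin; zero; suc)
open import Data.Integer as ℤ using (+_)
import Data.Integer.Properties as ℤ
open import Data.List using (List; []; _∷_; _++_; replicate; length)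
open import Data.List.Properties using (∷-injective; ∷-injectiveˡ; length-replicate)
open import Data.List.Relation.Unary.All as All using (All; []; _∷_)
import Data.List.Relation.Unary.All.Properties as All
open import Data.List.Relation.Unary.AllPairs as AllPairs using (AllPairs; []; _∷_)
import Data.List.Relation.Unary.AllPairs.Properties as AllPairs
open import Data.List.Relation.Unary.Linked.Properties using (AllPairs⇒Linked)
open import Data.Nat as ℕ using (ℕ; zero; suc; _!; _≤_; _<_; _≥_; NonZero; z≤n; s≤s)
import Data.Nat.ListAction as ℕ
import Data.Nat.ListAction.Properties as ℕ
import Data.Nat.Properties as ℕ
open import Data.Product using (Σ; _×_; _,_; map₁)
open import Data.Rational using (ℚ; 0ℚ; 1ℚ; _+_; _*_; toℚᵘ)
open import Data.Rational.Properties
  using ( _≟_; +-*-commutativeRing; +-0-group; *-1-commutativeMonoid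
        ; +-assoc; *-assoc; *-identityˡ; *-zeroˡ; *-zeroʳ; *-distribˡ-+
        ; toℚᵘ-injective; toℚᵘ-fromℚᵘ; toℚᵘ-homo-+; toℚᵘ-homo-*)
import Data.Rational.Unnormalised as ℚᵘ
import Data.Rational.Unnormalised.Properties as ℚᵘ
open import Data.Vec as Vec using (Vec; []; _∷_; lookup; toList)
open import Function using (_∘_)
open import Relation.Binary.Definitions using (Reflexive)
open import Relation.Binary.PropositionalEquality
open import Relation.Nullary using (contradiction)
open import Relation.Nullary.Decidable using (dec⇒maybe)
open import Tactic.RingSolver using (solve-∀)
open import Tactic.RingSolver.Core.AlmostCommutativeRing
  using (AlmostCommutativeRing; fromCommutativeRing)

toℚᵘ-ℕtoℚ : ∀ m → toℚᵘ (ℕtoℚ m) ℚᵘ.≃ ℚᵘ.mkℚᵘ (+ m) 0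
toℚᵘ-ℕtoℚ m = toℚᵘ-fromℚᵘ (ℚᵘ.mkℚᵘ (+ m) 0)

ℕtoℚ-+ : ∀ m n → ℕtoℚ (m ℕ.+ n) ≡ ℕtoℚ m + ℕtoℚ n
ℕtoℚ-+ m n = toℚᵘ-injective (begin
  toℚᵘ (ℕtoℚ (m ℕ.+ n))                 ≈⟨ toℚᵘ-ℕtoℚ (m ℕ.+ n) ⟩
  ℚᵘ.mkℚᵘ (+ (m ℕ.+ n)) 0               ≈⟨ ℚᵘ.*≡* numerators ⟩
  ℚᵘ.mkℚᵘ (+ m) 0 ℚᵘ.+ ℚᵘ.mkℚᵘ (+ n) 0  ≈⟨ ℚᵘ.+-cong (toℚᵘ-ℕtoℚ m) (toℚᵘ-ℕtoℚ n) ⟨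
  toℚᵘ (ℕtoℚ m) ℚᵘ.+ toℚᵘ (ℕtoℚ n)      ≈⟨ toℚᵘ-homo-+ (ℕtoℚ m) (ℕtoℚ n) ⟨
  toℚᵘ (ℕtoℚ m + ℕtoℚ n)                ∎)
  where
  open ℚᵘ.≃-Reasoning
  numerators : + (m ℕ.+ n) ℤ.* + 1 ≡ (+ m ℤ.* + 1 ℤ.+ + n ℤ.* + 1) ℤ.* + 1
  numerators rewrite ℤ.*-identityʳ (+ m) | ℤ.*-identityʳ (+ n) =
    cong (ℤ._* + 1) (ℤ.pos-+ m n)

ℕtoℚ-* : ∀ m n → ℕtoℚ (m ℕ.* n) ≡ ℕtoℚ m * ℕtoℚ n
ℕtoℚ-* m n = toℚᵘ-injective (begin
  toℚᵘ (ℕtoℚ (m ℕ.* n))                 ≈⟨ toℚᵘ-ℕtoℚ (m ℕ.* n) ⟩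
  ℚᵘ.mkℚᵘ (+ (m ℕ.* n)) 0               ≈⟨ ℚᵘ.*≡* (cong (ℤ._* + 1) (ℤ.pos-* m n)) ⟩
  ℚᵘ.mkℚᵘ (+ m) 0 ℚᵘ.* ℚᵘ.mkℚᵘ (+ n) 0  ≈⟨ ℚᵘ.*-cong (toℚᵘ-ℕtoℚ m) (toℚᵘ-ℕtoℚ n) ⟨
  toℚᵘ (ℕtoℚ m) ℚᵘ.* toℚᵘ (ℕtoℚ n)      ≈⟨ toℚᵘ-homo-* (ℕtoℚ m) (ℕtoℚ n) ⟨
  toℚᵘ (ℕtoℚ m * ℕtoℚ n)                ∎)
  where open ℚᵘ.≃-Reasoning

ℕtoℚ-*-invℕ : ∀ m .{{_ : NonZero m}} → ℕtoℚ m * invℕ m ≡ 1ℚ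
ℕtoℚ-*-invℕ (suc m) = toℚᵘ-injective (begin
  toℚᵘ (ℕtoℚ (suc m) * invℕ (suc m))           ≈⟨ toℚᵘ-homo-* (ℕtoℚ (suc m)) (invℕ (suc m)) ⟩
  toℚᵘ (ℕtoℚ (suc m)) ℚᵘ.* toℚᵘ (invℕ (suc m)) ≈⟨ ℚᵘ.*-cong (toℚᵘ-ℕtoℚ (suc m)) (toℚᵘ-fromℚᵘ (ℚᵘ.1/ p)) ⟩
  p ℚᵘ.* ℚᵘ.1/ p                                ≈⟨ ℚᵘ.*-inverseʳ p ⟩
  ℚᵘ.1ℚᵘ                                        ∎)
  where
  open ℚᵘ.≃-Reasoning
  p : ℚᵘ.ℚᵘ
  p = ℚᵘ.mkℚᵘ (+ suc m) 0

ℚ-ring : AlmostCommutativeRing _ _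
ℚ-ring = fromCommutativeRing +-*-commutativeRing (λ x → dec⇒maybe (0ℚ ≟ x))

open SemiringSum (CommutativeRing.semiring +-*-commutativeRing)
  using (sum; sum-cong-≗; ∑-distrib-+; *-distribˡ-sum; *-distribʳ-sum)
open GroupProperties +-0-group using (∙-cancelʳ)
open CommutativeSemigroupProperties (CommutativeMonoid.commutativeSemigroup *-1-commutativeMonoid)
  using (x∙yz≈y∙xz)
open CommutativeSemigroupProperties ℕ.*-commutativeSemigroup
  using () renaming (x∙yz≈y∙xz to m*[n*o]≡n*[m*o])

sumFin≡sum : ∀ {k} (f : Fin k → ℚ) → sumFin f ≡ sum f
sumFin≡sum {zero}  f = refl
sumFin≡sum {suc k} f = cong (λ s → f zero + s) (sumFin≡sum (f ∘ suc))

sumFin-cong : ∀ {k} {f g : Fin k → ℚ} → (∀ j → f j ≡ g j) → sumFin f ≡ sumFin g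
sumFin-cong {f = f} {g} f≗g =
  trans (sumFin≡sum f) (trans (sum-cong-≗ f≗g) (sym (sumFin≡sum g)))

sumFin-+ : ∀ {k} (f g : Fin k → ℚ) → sumFin (λ j → f j + g j) ≡ sumFin f + sumFin g
sumFin-+ f g = begin
  sumFin (λ j → f j + g j)  ≡⟨ sumFin≡sum (λ j → f j + g j) ⟩
  sum (λ j → f j + g j)     ≡⟨ ∑-distrib-+ f g ⟩
  sum f + sum g             ≡⟨ cong₂ _+_ (sumFin≡sum f) (sumFin≡sum g) ⟨
  sumFin f + sumFin g       ∎
  where open ≡-Reasoning

sumFin-*ˡ : ∀ {k} c (f : Fin k → ℚ) → sumFin (λ j → c * f j) ≡ c * sumFin f
sumFin-*ˡ c f = begin
  sumFin (λ j → c * f j)  ≡⟨ sumFin≡sum (λ j → c * f j) ⟩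
  sum (λ j → c * f j)     ≡⟨ *-distribˡ-sum c f ⟨
  c * sum f               ≡⟨ cong (c *_) (sumFin≡sum f) ⟨
  c * sumFin f            ∎
  where open ≡-Reasoning

sumFin-*ʳ : ∀ {k} c (f : Fin k → ℚ) → sumFin (λ j → f j * c) ≡ sumFin f * c
sumFin-*ʳ c f = begin
  sumFin (λ j → f j * c)  ≡⟨ sumFin≡sum (λ j → f j * c) ⟩
  sum (λ j → f j * c)     ≡⟨ *-distribʳ-sum c f ⟨
  sum f * c               ≡⟨ cong (_* c) (sumFin≡sum f) ⟨
  sumFin f * c            ∎
  where open ≡-Reasoning

sumFin-lookup : ∀ {k} (α : Vec ℕ k) → sumFin (ℕtoℚ ∘ lookup α) ≡ ℕtoℚ (depth α)
sumFin-lookup []       = refl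
sumFin-lookup (a ∷ as) = trans (cong (λ s → ℕtoℚ a + s) (sumFin-lookup as)) (sym (ℕtoℚ-+ a (depth as)))

∏! : ∀ {k} → Vec ℕ k → ℕ
∏! α = ℕ.product (toList (Vec.map _! α))

∏!≢0 : ∀ {k} (α : Vec ℕ k) → NonZero (∏! α)
∏!≢0 []       = _
∏!≢0 (a ∷ as) = ℕ.m*n≢0 (a !) (∏! as) {{a ℕ.!≢0}} {{∏!≢0 as}}

depth-minusE : ∀ {k} (α : Vec ℕ k) j {m} → lookup α j ≡ suc m →
               depth α ≡ suc (depth (minusE α j))
depth-minusE (a ∷ as) zero    refl = refl
depth-minusE (a ∷ as) (suc j) αⱼ≡1+m =
  trans (cong (a ℕ.+_) (depth-minusE as j αⱼ≡1+m)) (ℕ.+-suc a _)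

∏!-minusE : ∀ {k} (α : Vec ℕ k) j {m} → lookup α j ≡ suc m →
            ∏! α ≡ suc m ℕ.* ∏! (minusE α j)
∏!-minusE (a ∷ as) zero {m} refl = ℕ.*-assoc (suc m) (m !) (∏! as)
∏!-minusE (a ∷ as) (suc j) {m} αⱼ≡1+m = begin
  a ! ℕ.* ∏! as                             ≡⟨ cong (a ! ℕ.*_) (∏!-minusE as j αⱼ≡1+m) ⟩
  a ! ℕ.* (suc m ℕ.* ∏! (minusE as j))     ≡⟨ m*[n*o]≡n*[m*o] (a !) (suc m) _ ⟩
  suc m ℕ.* (a ! ℕ.* ∏! (minusE as j))     ∎
  where open ≡-Reasoning

weightedSum-minusE : ∀ {k} (ω : Fin k → ℚ) (α : Vec ℕ k) j {m} → lookup α j ≡ suc m →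
                     weightedSum ω α ≡ weightedSum ω (minusE α j) + ω j
weightedSum-minusE ω (a ∷ as) zero {m} refl = begin
  ℕtoℚ (suc m) * ω₀ + W             ≡⟨ cong (λ x → x * ω₀ + W) (ℕtoℚ-+ 1 m) ⟩
  (1ℚ + ℕtoℚ m) * ω₀ + W            ≡⟨ regroup ω₀ (ℕtoℚ m) W ⟩
  (ℕtoℚ m * ω₀ + W) + ω₀            ∎
  where
  open ≡-Reasoning
  ω₀ : ℚ
  ω₀ = ω zero
  W : ℚ
  W = weightedSum (ω ∘ suc) as
  regroup : ∀ x y z → (1ℚ + y) * x + z ≡ (y * x + z) + x
  regroup = solve-∀ ℚ-ring
weightedSum-minusE ω (a ∷ as) (suc j) αⱼ≡1+m = begin
  ℕtoℚ a * ω zero + weightedSum (ω ∘ suc) as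
    ≡⟨ cong (λ s → ℕtoℚ a * ω zero + s) (weightedSum-minusE (ω ∘ suc) as j αⱼ≡1+m) ⟩
  ℕtoℚ a * ω zero + (weightedSum (ω ∘ suc) (minusE as j) + ω (suc j))
    ≡⟨ +-assoc (ℕtoℚ a * ω zero) _ (ω (suc j)) ⟨
  ℕtoℚ a * ω zero + weightedSum (ω ∘ suc) (minusE as j) + ω (suc j)
    ∎
  where open ≡-Reasoning

lookup-*-weightedSum-minusE : ∀ {k} (ω : Fin k → ℚ) (α : Vec ℕ k) j →
  ℕtoℚ (lookup α j) * (weightedSum ω (minusE α j) + ω j) ≡ ℕtoℚ (lookup α j) * weightedSum ω α
lookup-*-weightedSum-minusE ω α j with lookup α j in αⱼ≡
... | zero  = trans (*-zeroˡ (weightedSum ω (minusE α j) + ω j)) (sym (*-zeroˡ (weightedSum ω α)))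
... | suc m = cong (ℕtoℚ (suc m) *_) (sym (weightedSum-minusE ω α j αⱼ≡))

sumFin-lookup-*-weightedSum-minusE : ∀ {k} (ω : Fin k → ℚ) (α : Vec ℕ k) {d} → depth α ≡ suc d →
  sumFin (λ j → ℕtoℚ (lookup α j) * weightedSum ω (minusE α j)) ≡ ℕtoℚ d * weightedSum ω α
sumFin-lookup-*-weightedSum-minusE ω α {d} |α|≡1+d = ∙-cancelʳ W S (ℕtoℚ d * W) (begin
  S + W
    ≡⟨ sumFin-+ (λ j → αⱼ j * weightedSum ω (minusE α j)) (λ j → αⱼ j * ω j) ⟨
  sumFin (λ j → αⱼ j * weightedSum ω (minusE α j) + αⱼ j * ω j)
    ≡⟨ sumFin-cong (λ j → trans (sym (*-distribˡ-+ (αⱼ j) _ (ω j))) (lookup-*-weightedSum-minusE ω α j)) ⟩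
  sumFin (λ j → αⱼ j * W)
    ≡⟨ sumFin-*ʳ W αⱼ ⟩
  sumFin αⱼ * W
    ≡⟨ cong (_* W) (trans (sumFin-lookup α) (cong ℕtoℚ |α|≡1+d)) ⟩
  ℕtoℚ (suc d) * W
    ≡⟨ cong (_* W) (ℕtoℚ-+ 1 d) ⟩
  (1ℚ + ℕtoℚ d) * W
    ≡⟨ distrib W (ℕtoℚ d) ⟩
  ℕtoℚ d * W + W
    ∎)
  where
  open ≡-Reasoning
  αⱼ : Fin _ → ℚ
  αⱼ = ℕtoℚ ∘ lookup α
  W S : ℚ
  W = weightedSum ω α
  S = sumFin (λ j → αⱼ j * weightedSum ω (minusE α j))
  distrib : ∀ w x → (1ℚ + x) * w ≡ x * w + w
  distrib = solve-∀ ℚ-ring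

∏!≡1 : ∀ {k} (α : Vec ℕ k) → depth α ≤ 1 → ∏! α ≡ 1
∏!≡1 []                   _         = refl
∏!≡1 (zero ∷ as)          |α|≤1     = trans (ℕ.*-identityˡ (∏! as)) (∏!≡1 as |α|≤1)
∏!≡1 (suc zero ∷ as)      (s≤s |as|≤0) = trans (ℕ.*-identityˡ (∏! as)) (∏!≡1 as (ℕ.≤-trans |as|≤0 z≤n))
∏!≡1 (suc (suc a) ∷ as)   (s≤s ())

Aᵈ1≡weightedSum : ∀ {k} (ω : Fin k → ℚ) (α : Vec ℕ k) → depth α ≤ 1 → Aᵈ 1 ω α ≡ weightedSum ω α
Aᵈ1≡weightedSum ω []                 _            = refl
Aᵈ1≡weightedSum ω (zero ∷ as)        |α|≤1        =
  cong₂ _+_ (sym (*-zeroˡ (ω zero))) (Aᵈ1≡weightedSum (ω ∘ suc) as |α|≤1)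
Aᵈ1≡weightedSum ω (suc zero ∷ as)    (s≤s |as|≤0) =
  cong₂ _+_ (sym (*-identityˡ (ω zero))) (Aᵈ1≡weightedSum (ω ∘ suc) as (ℕ.≤-trans |as|≤0 z≤n))
Aᵈ1≡weightedSum ω (suc (suc a) ∷ as) (s≤s ())

∏!-*-Aᵈ : ∀ {k} (ω : Fin k → ℚ) d (α : Vec ℕ k) → depth α ≡ suc d →
          ℕtoℚ (∏! α) * Aᵈ (suc d) ω α ≡ ℕtoℚ (d !) * weightedSum ω α
∏!-*-Aᵈ ω zero α |α|≡1 rewrite ∏!≡1 α (ℕ.≤-reflexive |α|≡1) =
  cong (1ℚ *_) (Aᵈ1≡weightedSum ω α (ℕ.≤-reflexive |α|≡1))
∏!-*-Aᵈ ω (suc d) α |α|≡2+d = begin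
  P * sumFin (λ j → ifPos (lookup α j) (A′ j))
    ≡⟨ sumFin-*ˡ P (λ j → ifPos (lookup α j) (A′ j)) ⟨
  sumFin (λ j → P * ifPos (lookup α j) (A′ j))
    ≡⟨ sumFin-cong term ⟩
  sumFin (λ j → ℕtoℚ (d !) * (ℕtoℚ (lookup α j) * W′ j))
    ≡⟨ sumFin-*ˡ (ℕtoℚ (d !)) (λ j → ℕtoℚ (lookup α j) * W′ j) ⟩
  ℕtoℚ (d !) * sumFin (λ j → ℕtoℚ (lookup α j) * W′ j)
    ≡⟨ cong (ℕtoℚ (d !) *_) (sumFin-lookup-*-weightedSum-minusE ω α |α|≡2+d) ⟩
  ℕtoℚ (d !) * (ℕtoℚ (suc d) * W)
    ≡⟨ x∙yz≈y∙xz (ℕtoℚ (d !)) (ℕtoℚ (suc d)) W ⟩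
  ℕtoℚ (suc d) * (ℕtoℚ (d !) * W)
    ≡⟨ *-assoc (ℕtoℚ (suc d)) (ℕtoℚ (d !)) W ⟨
  ℕtoℚ (suc d) * ℕtoℚ (d !) * W
    ≡⟨ cong (_* W) (ℕtoℚ-* (suc d) (d !)) ⟨
  ℕtoℚ (suc d !) * W
    ∎
  where
  open ≡-Reasoning
  P W : ℚ
  P = ℕtoℚ (∏! α)
  W = weightedSum ω α
  A′ W′ : Fin _ → ℚ
  A′ j = Aᵈ (suc d) ω (minusE α j)
  W′ j = weightedSum ω (minusE α j)
  term : ∀ j → P * ifPos (lookup α j) (A′ j) ≡ ℕtoℚ (d !) * (ℕtoℚ (lookup α j) * W′ j)
  term j with lookup α j in αⱼ≡
  ... | zero  = trans (*-zeroʳ P) (sym (trans (cong (ℕtoℚ (d !) *_) (*-zeroˡ (W′ j))) (*-zeroʳ (ℕtoℚ (d !)))))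
  ... | suc m = begin
    P * A′ j                                   ≡⟨ cong (λ n → ℕtoℚ n * A′ j) (∏!-minusE α j αⱼ≡) ⟩
    ℕtoℚ (suc m ℕ.* ∏! α′) * A′ j              ≡⟨ cong (_* A′ j) (ℕtoℚ-* (suc m) (∏! α′)) ⟩
    ℕtoℚ (suc m) * ℕtoℚ (∏! α′) * A′ j         ≡⟨ *-assoc (ℕtoℚ (suc m)) _ (A′ j) ⟩
    ℕtoℚ (suc m) * (ℕtoℚ (∏! α′) * A′ j)       ≡⟨ cong (ℕtoℚ (suc m) *_) (∏!-*-Aᵈ ω d α′ |α′|≡1+d) ⟩
    ℕtoℚ (suc m) * (ℕtoℚ (d !) * W′ j)         ≡⟨ x∙yz≈y∙xz (ℕtoℚ (suc m)) (ℕtoℚ (d !)) (W′ j) ⟩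
    ℕtoℚ (d !) * (ℕtoℚ (suc m) * W′ j)         ∎
    where
    α′ : Vec ℕ _
    α′ = minusE α j
    |α′|≡1+d : depth α′ ≡ suc d
    |α′|≡1+d = ℕ.suc-injective (trans (sym (depth-minusE α j αⱼ≡)) |α|≡2+d)

A-closedForm : ∀ {k} (ω : Fin k → ℚ) (α : Vec ℕ k) → depth α ≢ 0 →
               A ω α ≡ multinomial α * weightedSum ω α * invℕ (depth α)
A-closedForm ω α |α|≢0 with depth α in |α|≡
... | zero  = contradiction refl |α|≢0
... | suc d = sym (begin
  ℕtoℚ (suc d !) * P⁻¹ * W * n⁻¹              ≡⟨ cong (λ x → x * P⁻¹ * W * n⁻¹) (ℕtoℚ-* (suc d) (d !)) ⟩
  ℕtoℚ (suc d) * ℕtoℚ (d !) * P⁻¹ * W * n⁻¹   ≡⟨ regroup (ℕtoℚ (suc d)) (ℕtoℚ (d !)) P⁻¹ W n⁻¹ ⟩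
  (ℕtoℚ (suc d) * n⁻¹) * (P⁻¹ * (ℕtoℚ (d !) * W))
    ≡⟨ cong₂ (λ x y → x * (P⁻¹ * y)) (ℕtoℚ-*-invℕ (suc d)) (sym (∏!-*-Aᵈ ω d α |α|≡)) ⟩
  1ℚ * (P⁻¹ * (P * X))                         ≡⟨ regroup′ P⁻¹ P X ⟩
  (P * P⁻¹) * X                               ≡⟨ cong (_* X) (ℕtoℚ-*-invℕ (∏! α) {{∏!≢0 α}}) ⟩
  1ℚ * X                                      ≡⟨ *-identityˡ X ⟩
  X                                           ∎)
  where
  open ≡-Reasoning
  P P⁻¹ n⁻¹ W X : ℚ
  P   = ℕtoℚ (∏! α)
  P⁻¹ = invℕ (∏! α)
  n⁻¹ = invℕ (suc d)
  W   = weightedSum ω α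
  X   = Aᵈ (suc d) ω α
  regroup : ∀ n f p w m → n * f * p * w * m ≡ (n * m) * (p * (f * w))
  regroup = solve-∀ ℚ-ring
  regroup′ : ∀ p q x → 1ℚ * (p * (q * x)) ≡ (q * p) * x
  regroup′ = solve-∀ ℚ-ring

AllPairs-replicate : ∀ {a r} {A : Set a} {R : A → A → Set r} → Reflexive R →
                     ∀ n {x} → AllPairs R (replicate n x)
AllPairs-replicate refl-R zero    = []
AllPairs-replicate refl-R (suc n) = All.replicate⁺ n refl-R ∷ AllPairs-replicate refl-R n

sum-replicate : ∀ n x → ℕ.sum (replicate n x) ≡ n ℕ.* x
sum-replicate zero    x = refl
sum-replicate (suc n) x = cong (x ℕ.+_) (sum-replicate n x)

++-replicate-injective : ∀ {s} {xs ys : List ℕ} a b → All (s <_) xs → All (s <_) ys →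
                         xs ++ replicate a s ≡ ys ++ replicate b s → xs ≡ ys × a ≡ b
++-replicate-injective {xs = []}     {[]}     a       b       _          _          eq =
  refl , trans (sym (length-replicate a)) (trans (cong length eq) (length-replicate b))
++-replicate-injective {xs = []}     {y ∷ ys} (suc a) b       _          (s<y ∷ _)  eq =
  ⊥-elim (ℕ.<-irrefl (∷-injectiveˡ eq) s<y)
++-replicate-injective {xs = x ∷ xs} {[]}     a       (suc b) (s<x ∷ _)  _          eq =
  ⊥-elim (ℕ.<-irrefl (sym (∷-injectiveˡ eq)) s<x)
++-replicate-injective {xs = x ∷ xs} {y ∷ ys} a       b       (_ ∷ s<xs) (_ ∷ s<ys) eq
  with ∷-injective eq
... | refl , eq′ = map₁ (cong (x ∷_)) (++-replicate-injective a b s<xs s<ys eq′)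

toParts : ∀ {k} → ℕ → Vec ℕ k → List ℕ
toParts s []       = []
toParts s (a ∷ as) = toParts (suc s) as ++ replicate a s

toParts-≥ : ∀ {k} s (α : Vec ℕ k) → All (s ≤_) (toParts s α)
toParts-≥ s []       = []
toParts-≥ s (a ∷ as) = All.++⁺ (All.map ℕ.<⇒≤ (toParts-≥ (suc s) as)) (All.replicate⁺ a ℕ.≤-refl)

toParts-sorted : ∀ {k} s (α : Vec ℕ k) → AllPairs _≥_ (toParts s α)
toParts-sorted s []       = []
toParts-sorted s (a ∷ as) = AllPairs.++⁺
  (toParts-sorted (suc s) as)
  (AllPairs-replicate ℕ.≤-refl a)
  (All.map (λ s<x → All.replicate⁺ a (ℕ.<⇒≤ s<x)) (toParts-≥ (suc s) as))

sum-toParts : ∀ {k} s (α : Vec ℕ k) → ℕ.sum (toParts s α) ≡ levelFrom s α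
sum-toParts s []       = refl
sum-toParts s (a ∷ as) = begin
  ℕ.sum (toParts (suc s) as ++ replicate a s)           ≡⟨ ℕ.sum-++ (toParts (suc s) as) (replicate a s) ⟩
  ℕ.sum (toParts (suc s) as) ℕ.+ ℕ.sum (replicate a s)  ≡⟨ cong₂ ℕ._+_ (sum-toParts (suc s) as) (sum-replicate a s) ⟩
  levelFrom (suc s) as ℕ.+ a ℕ.* s                     ≡⟨ ℕ.+-comm _ (a ℕ.* s) ⟩
  a ℕ.* s ℕ.+ levelFrom (suc s) as                     ≡⟨ cong (ℕ._+ levelFrom (suc s) as) (ℕ.*-comm a s) ⟩
  s ℕ.* a ℕ.+ levelFrom (suc s) as                     ∎
  where open ≡-Reasoning

toParts-injective : ∀ {k} s (α β : Vec ℕ k) → toParts s α ≡ toParts s β → α ≡ β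
toParts-injective s []       []       _  = refl
toParts-injective s (a ∷ as) (b ∷ bs) eq
  with ++-replicate-injective a b (toParts-≥ (suc s) as) (toParts-≥ (suc s) bs) eq
... | eq′ , a≡b = cong₂ _∷_ a≡b (toParts-injective (suc s) as bs eq′)

toPartition : ∀ {k n} (α : Vec ℕ k) → level α ≡ n → Partition n
toPartition α level≡n = record
  { parts    = toParts 1 α
  ; positive = toParts-≥ 1 α
  ; nonincr  = AllPairs⇒Linked (toParts-sorted 1 α)
  ; total    = trans (sum-toParts 1 α) level≡n
  }

levelFrom-depth≡0 : ∀ {k} s (α : Vec ℕ k) → depth α ≡ 0 → levelFrom s α ≡ 0
levelFrom-depth≡0 s []          _     = refl
levelFrom-depth≡0 s (zero ∷ as) |as|≡0 = cong₂ ℕ._+_ (ℕ.*-zeroʳ s) (levelFrom-depth≡0 (suc s) as |as|≡0)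

theorem1 : (k : ℕ) → k ≥ 1 → (ω : Fin k → ℚ) → (n : ℕ) → n ≥ 1 →
    (Σ ((α : Vec ℕ k) → level α ≡ n → A ω α ≢ 0ℚ → Partition n) λ f →
    (α β : Vec ℕ k) (lα : level α ≡ n) (lβ : level β ≡ n)
    (nα : A ω α ≢ 0ℚ) (nβ : A ω β ≢ 0ℚ) →
    parts (f α lα nα) ≡ parts (f β lβ nβ) → α ≡ β)
    × ((α : Vec ℕ k) → level α ≡ n →
    A ω α ≡ multinomial α * weightedSum ω α * invℕ (depth α))
theorem1 k _ ω n n≥1 =
  ((λ α level≡n _ → toPartition α level≡n) , λ α β _ _ _ _ → toParts-injective 1 α β) ,
  λ α level≡n → A-closedForm ω α (λ |α|≡0 →
    ℕ.m<n⇒n≢0 n≥1 (trans (sym level≡n) (levelFrom-depth≡0 1 α |α|≡0)))
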